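{- Let $\mathcal{F}$ be a finite poset equipped with an associative product $\mathcal{F}\times\mathcal{F}\to\mathcal{F}$, and let $\mathcal{C}$, the set of maximal elements of $\mathcal{F}$, be a left ideal (i.e. $FC\in\mathcal{C}$ for all $F\in\mathcal{F}$, $C\in\mathcal{C}$). Assume that for $F\in\mathcal{F}$, $C,D\in\mathcal{C}$: (i) if $FC=D$ then $F\le D$; (ii) if $F\le C$ then $FC=C$; (iii) if $FC=D$ and $F\le G\le D$ then $GC=D$; and moreover $F\le FF'$ for all $F,F'\in\mathcal{F}$. Then $\mathcal{F}$ satisfies: whenever $C\in\mathcal{C}$, $FC=D$ and $C_1,\dots,C_n=D$ is a weak $C$-gallery, we have $FC_1=D$.
   Context: A weak $C$-gallery is a sequence of elements $C_1,\dots,C_n$ of $\mathcal{C}$ together with elements $F_1,\dots,F_{n-1}\in\mathcal{F}$ such that $F_iC=C_i$ and $F_i\le C_i$, $F_i\le C_{i+1}$ for each $i$. -}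

module Defs where

open import Data.Nat using (ℕ; suc)
open import Data.Fin using (Fin; zero; suc; inject₁; fromℕ)
open import Data.Product using (_×_)
open import Relation.Binary.PropositionalEquality using (_≡_)

IsMaximal : {X : Set} → (X → X → Set) → X → Set
IsMaximal {X} _≤_ x = (y : X) → x ≤ y → y ≡ x

-- A weak C-gallery C₁,…,Cₙ (here indexed by Fin (suc n), so it has n+1 ≥ 1
-- chambers) with connecting faces F₁,…,Fₙ (indexed by Fin n):
-- every Cᵢ is maximal, and Fᵢ · C = Cᵢ, Fᵢ ≤ Cᵢ, Fᵢ ≤ Cᵢ₊₁.
record WeakGallery {X : Set} (_≤_ : X → X → Set) (_·_ : X → X → X)
                   (C : X) (n : ℕ) (Cs : Fin (suc n) → X) (Fs : Fin n → X) : Set where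
  field
    chambers : (i : Fin (suc n)) → IsMaximal _≤_ (Cs i)
    faceProd : (i : Fin n) → (Fs i · C) ≡ Cs (inject₁ i)
    faceLeft : (i : Fin n) → Fs i ≤ Cs (inject₁ i)
    faceRight : (i : Fin n) → Fs i ≤ Cs (suc i)

{-# OPTIONS --safe #-}
-- Induction along the gallery from its last chamber D = Cₙ backwards. If F · Cᵢ₊₁ = D
-- and the panel Fᵢ ≤ Cᵢ₊₁, then (F · Fᵢ) · Cᵢ₊₁ = F · Cᵢ₊₁ = D, so F ≤ F · Fᵢ ≤ D;
-- axiom (iii) applied to F · C = D then gives F · Cᵢ = (F · Fᵢ) · C = D.
module Submission where

open import Defs
open import Data.Nat using (ℕ; suc)
open import Data.Fin using (Fin; zero; suc; fromℕ)
open import Function using (_∘_)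
open import Relation.Binary.PropositionalEquality using (_≡_; cong; sym; module ≡-Reasoning)
open import Relation.Binary.Structures using (IsPartialOrder)

WeakGallery-tail : ∀ {X : Set} {_≤_ : X → X → Set} {_·_ : X → X → X} {C : X} {n : ℕ}
                   {Cs : Fin (suc (suc n)) → X} {Fs : Fin (suc n) → X} →
                   WeakGallery _≤_ _·_ C (suc n) Cs Fs →
                   WeakGallery _≤_ _·_ C n (Cs ∘ suc) (Fs ∘ suc)
WeakGallery-tail g = record
  { chambers  = chambers ∘ suc
  ; faceProd  = faceProd ∘ suc
  ; faceLeft  = faceLeft ∘ suc
  ; faceRight = faceRight ∘ suc
  }
  where open WeakGallery g

module _ {X : Set} (_≤_ : X → X → Set) (_·_ : X → X → X)
  (·-assoc : ∀ x y z → ((x · y) · z) ≡ (x · (y · z)))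
  (≤-product : ∀ F C D → IsMaximal _≤_ C → IsMaximal _≤_ D → (F · C) ≡ D → F ≤ D)
  (absorb : ∀ F C → IsMaximal _≤_ C → F ≤ C → (F · C) ≡ C)
  (product-between : ∀ F G C D → IsMaximal _≤_ C → IsMaximal _≤_ D →
                     (F · C) ≡ D → F ≤ G → G ≤ D → (G · C) ≡ D)
  (≤-·ʳ : ∀ F F′ → F ≤ (F · F′))
  where

  product-stable-across-panel :
    ∀ {C F D P Cᵢ Cⱼ} → IsMaximal _≤_ C → IsMaximal _≤_ D → (F · C) ≡ D →
    (P · C) ≡ Cᵢ → P ≤ Cⱼ → IsMaximal _≤_ Cⱼ → (F · Cⱼ) ≡ D → (F · Cᵢ) ≡ D
  product-stable-across-panel {C} {F} {D} {P} {Cᵢ} {Cⱼ} maxC maxD FC≡D PC≡Cᵢ P≤Cⱼ maxCⱼ FCⱼ≡D =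
    begin
      F · Cᵢ        ≡⟨ cong (F ·_) (sym PC≡Cᵢ) ⟩
      F · (P · C)   ≡⟨ sym (·-assoc F P C) ⟩
      (F · P) · C   ≡⟨ product-between F (F · P) C D maxC maxD FC≡D (≤-·ʳ F P) FP≤D ⟩
      D             ∎
    where
    open ≡-Reasoning
    FP·Cⱼ≡D : ((F · P) · Cⱼ) ≡ D
    FP·Cⱼ≡D = begin
      (F · P) · Cⱼ  ≡⟨ ·-assoc F P Cⱼ ⟩
      F · (P · Cⱼ)  ≡⟨ cong (F ·_) (absorb P Cⱼ maxCⱼ P≤Cⱼ) ⟩
      F · Cⱼ        ≡⟨ FCⱼ≡D ⟩
      D             ∎
    FP≤D : (F · P) ≤ D
    FP≤D = ≤-product (F · P) Cⱼ D maxCⱼ maxD FP·Cⱼ≡D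

  product-constant-on-gallery :
    ∀ {C F D} → IsMaximal _≤_ C → IsMaximal _≤_ D → (F · C) ≡ D →
    (n : ℕ) (Cs : Fin (suc n) → X) (Fs : Fin n → X) →
    WeakGallery _≤_ _·_ C n Cs Fs → Cs (fromℕ n) ≡ D → (F · Cs zero) ≡ D
  product-constant-on-gallery {C} {F} {D} maxC maxD FC≡D = go
    where
    go : (n : ℕ) (Cs : Fin (suc n) → X) (Fs : Fin n → X) →
         WeakGallery _≤_ _·_ C n Cs Fs → Cs (fromℕ n) ≡ D → (F · Cs zero) ≡ D
    go ℕ.zero Cs Fs g Cₙ≡D = begin
      F · Cs zero  ≡⟨ cong (F ·_) Cₙ≡D ⟩
      F · D        ≡⟨ absorb F D maxD (≤-product F C D maxC maxD FC≡D) ⟩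
      D            ∎
      where open ≡-Reasoning
    go (suc n) Cs Fs g Cₙ≡D =
      product-stable-across-panel maxC maxD FC≡D (faceProd zero) (faceRight zero)
        (chambers (suc zero)) (go n (Cs ∘ suc) (Fs ∘ suc) (WeakGallery-tail g) Cₙ≡D)
      where open WeakGallery g

proposition5p1 : (m : ℕ) (_≤_ : Fin m → Fin m → Set) (_·_ : Fin m → Fin m → Fin m) →
    IsPartialOrder _≡_ _≤_ →
    (∀ x y z → ((x · y) · z) ≡ (x · (y · z))) →
    (∀ F C → IsMaximal _≤_ C → IsMaximal _≤_ (F · C)) →
    (∀ F C D → IsMaximal _≤_ C → IsMaximal _≤_ D → (F · C) ≡ D → F ≤ D) →
    (∀ F C → IsMaximal _≤_ C → F ≤ C → (F · C) ≡ C) →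
    (∀ F G C D → IsMaximal _≤_ C → IsMaximal _≤_ D →
      (F · C) ≡ D → F ≤ G → G ≤ D → (G · C) ≡ D) →
    (∀ F F′ → F ≤ (F · F′)) →
    ∀ (C F D : Fin m) → IsMaximal _≤_ C → (F · C) ≡ D →
    (n : ℕ) (Cs : Fin (suc n) → Fin m) (Fs : Fin n → Fin m) →
    WeakGallery _≤_ _·_ C n Cs Fs → Cs (fromℕ n) ≡ D →
    (F · Cs zero) ≡ D
proposition5p1 m _≤_ _·_ _ ·-assoc ideal ≤-product absorb product-between ≤-·ʳ C F D maxC FC≡D =
  product-constant-on-gallery _≤_ _·_ ·-assoc ≤-product absorb product-between ≤-·ʳ
    maxC maxD FC≡D
  where
  maxD : IsMaximal _≤_ D
  maxD rewrite sym FC≡D = ideal F C maxC
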